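{- For integers $n,m\ge0$ and trees $x\in Y_n$, $y\in Y_m$, let $c_{x,y}$ denote the number of trees in the grove $x+y$. Then $$\sum_{x\in Y_n,\,y\in Y_m}c_{x,y}=c_{n+m},$$ where $c_k=\frac{(2k)!}{k!\,(k+1)!}$ is the $k$-th Catalan number.
   Context: A planar binary tree of degree $n\ge 0$ is a planar rooted tree (up to planar isotopy) with $n+1$ leaves in which every internal vertex has exactly two inputs; $Y_n$ is the set of these trees (it has $c_n$ elements), $Y_0=\{|\}$. For $x\in Y_p$, $y\in Y_q$ the grafting $x\vee y$ joins the roots of $x$ and $y$ to a new vertex with a new root. Tamari order on $Y_n$: the smallest partial order with $(a\vee b)\vee c\le a\vee(b\vee c)$, and $a\le b\Rightarrow a\vee c\le b\vee c,\ c\vee a\le c\vee b$. $x/y\in Y_{p+q}$ identifies the root of $x$ with the leftmost leaf of $y$; $x\backslash y\in Y_{p+q}$ identifies the rightmost leaf of $x$ with the root of $y$. Sum of trees: $x+y:=\{z\in Y_{p+q}: x/y\le z\le x\backslash y\}$. -}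

module Defs where

open import Data.Nat using (ℕ; zero; suc; _+_; _*_; _!)
open import Data.Nat.DivMod using (_/_)
open import Data.Nat.Properties using (_!*_!≢0)
open import Data.List using (List; length; map)
open import Data.Nat.ListAction using (sum)
open import Data.List.Membership.Propositional using (_∈_)
open import Data.List.Relation.Unary.Unique.Propositional using (Unique)
open import Data.Product using (Σ; ∃; _×_)
open import Function.Bundles using (_⇔_)
open import Relation.Binary.PropositionalEquality using (_≡_)

-- Planar binary trees (up to planar isotopy = as plain syntax trees).
-- `leaf` is the tree | ; `x ∨ y` is the grafting of x and y.
data Tree : Set where
  leaf : Tree
  _∨_  : Tree → Tree → Tree

infixr 6 _∨_

-- degree = number of internal vertices (number of leaves minus one)
degree : Tree → ℕ
degree leaf    = zero
degree (x ∨ y) = suc (degree x + degree y)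

InY : ℕ → Tree → Set
InY n t = degree t ≡ n

data _≤T_ : Tree → Tree → Set where
  ≤T-refl  : ∀ {x} → x ≤T x
  ≤T-trans : ∀ {x y z} → x ≤T y → y ≤T z → x ≤T z
  ≤T-rot   : ∀ {a b c} → ((a ∨ b) ∨ c) ≤T (a ∨ (b ∨ c))
  ≤T-left  : ∀ {a b c} → a ≤T b → (a ∨ c) ≤T (b ∨ c)
  ≤T-right : ∀ {a b c} → a ≤T b → (c ∨ a) ≤T (c ∨ b)

-- x / y : identify the root of x with the leftmost leaf of y
_/T_ : Tree → Tree → Tree
x /T leaf    = x
x /T (l ∨ r) = (x /T l) ∨ r

-- x \ y : identify the rightmost leaf of x with the root of y
_╲T_ : Tree → Tree → Tree
leaf    ╲T y = y
(l ∨ r) ╲T y = l ∨ (r ╲T y)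

Grove : ℕ → ℕ → Tree → Tree → Tree → Set
Grove p q x y z = InY (p + q) z × ((x /T y) ≤T z) × (z ≤T (x ╲T y))

Enumerates : (Tree → Set) → List Tree → Set
Enumerates P L = Unique L × (∀ z → (z ∈ L) ⇔ P z)

HasCard : (Tree → Set) → ℕ → Set
HasCard P k = Σ (List Tree) λ L → Enumerates P L × (length L ≡ k)

catalan : ℕ → ℕ
catalan k = _/_ ((k + k) !) (k ! * (suc k) !) {{_!*_!≢0 k (suc k)}}

ΣΣ : List Tree → List Tree → (Tree → Tree → ℕ) → ℕ
ΣΣ Lx Ly c = sum (map (λ x → sum (map (λ y → c x y) Ly)) Lx)

-- Cutting a tree z of degree n + m at its leaf number n gives trees x = cutˡ n z and
-- y = cutʳ n z of degrees n and m with x / y ≤ z ≤ x \ y. Both cuts are monotone for the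
-- Tamari order, and they send x / y and x \ y to x and y; since the Tamari order is
-- antisymmetric, every z in a grove x + y has cuts x and y. So the groves partition
-- Y (n + m), and the double sum counts Y (n + m). Finally |Y k| = c k: a forest of r trees
-- with n internal vertices either starts with a leaf or comes from a forest of r + 1 trees
-- by grafting its first two trees. This is the recurrence of the ballot numbers, whose
-- closed form for a single tree is the Catalan number.
module Submission where

open import Defs
open import Data.Nat using (ℕ; zero; suc; _+_; _*_; _!; _≤_; _<_; z≤n; s≤s; s≤s⁻¹; z<s; NonZero)
open import Data.Nat.Properties
open import Data.Nat.DivMod using (_/_; m*n/n≡m; /-congˡ)
open import Data.Nat.ListAction using (sum)
open import Data.Nat.Tactic.RingSolver using (solve-∀)
open import Data.List using (List; []; _∷_; length; map; _++_)
open import Data.List.Properties using (length-++; length-map)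
open import Data.List.Membership.Propositional using (_∈_)
open import Data.List.Membership.Propositional.Properties using (∈-map⁺; ∈-map⁻; ∈-++⁺ˡ; ∈-++⁺ʳ; ∈-++⁻)
open import Data.List.Membership.Propositional.Properties.WithK using (unique∧set⇒bag)
open import Data.List.Relation.Binary.BagAndSetEquality using (∼bag⇒↭)
open import Data.List.Relation.Binary.Permutation.Propositional.Properties using (↭-length)
open import Data.List.Relation.Unary.Any using (here; there)
open import Data.List.Relation.Unary.All using ([]; lookup)
open import Data.List.Relation.Unary.AllPairs using ([]; _∷_)
open import Data.List.Relation.Unary.Unique.Propositional using (Unique)
import Data.List.Relation.Unary.Unique.Propositional.Properties as Unique
open import Data.Vec using (Vec; []; _∷_; replicate; head)
open import Data.Vec.Properties using (∷-injectiveʳ)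
open import Data.Product using (Σ; ∃-syntax; _×_; _,_; proj₁; proj₂)
open import Data.Sum using (_⊎_; inj₁; inj₂; [_,_])
open import Data.Empty using (⊥; ⊥-elim)
open import Function using (_∘_)
open import Function.Bundles using (_⇔_; mk⇔; Equivalence)
open import Function.Definitions using (Injective)
open import Relation.Binary.Bundles using (Preorder)
open import Relation.Binary.Structures using (IsPreorder)
open import Relation.Binary.PropositionalEquality using (_≡_; _≢_; refl; sym; trans; cong; cong₂; subst; subst₂; isEquivalence; module ≡-Reasoning)
open import Relation.Nullary using (¬_)
import Relation.Binary.Reasoning.Preorder as PreorderReasoning

-- ballot n r is the number of forests of r trees with n internal vertices in total.
ballot : ℕ → ℕ → ℕ
ballot zero    r       = 1
ballot (suc n) zero    = 0
ballot (suc n) (suc r) = ballot (suc n) r + ballot n (suc (suc r))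

ballot-step : ∀ n s G₁ G₂ P Q F →
  G₁ * (suc n * P * Q) ≡ s * F →
  G₂ * (P * (suc (suc n + s) * Q)) ≡ suc (suc s) * F →
  (G₁ + G₂) * (suc n * P * (suc (suc n + s) * Q)) ≡ suc s * (suc (suc n + n + s) * F)
ballot-step n s G₁ G₂ P Q F h₁ h₂ =
  trans (regroup n s G₁ G₂ P Q) (trans (cong₂ (λ u v → suc (suc n + s) * u + suc n * v) h₁ h₂) (collect n s F))
  where
  regroup : ∀ n s G₁ G₂ P Q → (G₁ + G₂) * (suc n * P * (suc (suc n + s) * Q)) ≡
            suc (suc n + s) * (G₁ * (suc n * P * Q)) + suc n * (G₂ * (P * (suc (suc n + s) * Q)))
  regroup = solve-∀
  collect : ∀ n s F → suc (suc n + s) * (s * F) + suc n * (suc (suc s) * F) ≡ suc s * (suc (suc n + n + s) * F)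
  collect = solve-∀

mutual
  ballot-suc-closed : ∀ n s → ballot (suc n) s * (suc n ! * (suc n + s) !) ≡ s * (suc n + n + s) !
  ballot-suc-closed n zero    = refl
  ballot-suc-closed n (suc s) = begin
      ballot (suc n) (suc s) * (suc n ! * (suc n + suc s) !)
    ≡⟨ cong (λ k → ballot (suc n) (suc s) * (suc n ! * k !)) (+-suc (suc n) s) ⟩
      ballot (suc n) (suc s) * (suc n ! * suc (suc n + s) !)
    ≡⟨ ballot-step n s (ballot (suc n) s) (ballot n (suc (suc s))) (n !) ((suc n + s) !) ((suc n + n + s) !)
                 (ballot-suc-closed n s) ballot-n-2+s ⟩
      suc s * suc (suc n + n + s) !
    ≡⟨ cong (λ k → suc s * k !) (+-suc (suc n + n) s) ⟨
      suc s * (suc n + n + suc s) !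
    ∎
    where
    open ≡-Reasoning
    ballot-n-2+s : ballot n (suc (suc s)) * (n ! * suc (suc n + s) !) ≡ suc (suc s) * (suc n + n + s) !
    ballot-n-2+s = subst₂ (λ i j → ballot n (suc (suc s)) * (n ! * i !) ≡ suc (suc s) * j !)
      (trans (+-suc n (suc s)) (cong suc (+-suc n s))) (+-suc (n + n) s) (ballot-closed n (suc s))

  ballot-closed : ∀ n s → ballot n (suc s) * (n ! * (n + suc s) !) ≡ suc s * (n + n + s) !
  ballot-closed zero    s = trans (*-identityˡ _) (*-identityˡ _)
  ballot-closed (suc n) s = trans (ballot-suc-closed n (suc s)) (cong (λ k → suc s * k !) (index n s))
    where
    index : ∀ n s → suc n + n + suc s ≡ suc n + suc n + s
    index = solve-∀

catalan-ballot : ∀ k → catalan k ≡ ballot k 1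
catalan-ballot k = begin
    (k + k) ! / (k ! * suc k !)                     ≡⟨ /-congˡ (sym ballot-k-1) ⟩
    ballot k 1 * (k ! * suc k !) / (k ! * suc k !)  ≡⟨ m*n/n≡m (ballot k 1) (k ! * suc k !) ⟩
    ballot k 1                                      ∎
  where
  open ≡-Reasoning
  instance
    k!*[1+k]!≢0 : NonZero (k ! * suc k !)
    k!*[1+k]!≢0 = _!*_!≢0 k (suc k)
  ballot-k-1 : ballot k 1 * (k ! * suc k !) ≡ (k + k) !
  ballot-k-1 = subst₂ (λ i j → ballot k 1 * (k ! * i !) ≡ j) (+-comm k 1)
                      (trans (*-identityˡ _) (cong _! (+-identityʳ (k + k)))) (ballot-closed k 0)

open Equivalence

-- Enumerates and HasCard of Defs for an arbitrary carrier; at Tree they are literally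
-- the same, so the lemmas below apply to HasCard directly.
module _ {A : Set} where

  Enumerates′ : (A → Set) → List A → Set
  Enumerates′ P L = Unique L × (∀ z → (z ∈ L) ⇔ P z)

  HasCard′ : (A → Set) → ℕ → Set
  HasCard′ P k = Σ (List A) λ L → Enumerates′ P L × (length L ≡ k)

  card-unique : ∀ {P k l} → HasCard′ P k → HasCard′ P l → k ≡ l
  card-unique (L₁ , (u₁ , L₁-spec) , refl) (L₂ , (u₂ , L₂-spec) , refl) =
    ↭-length (∼bag⇒↭ (unique∧set⇒bag u₁ u₂ λ {z} →
      mk⇔ (from (L₂-spec z) ∘ to (L₁-spec z)) (from (L₁-spec z) ∘ to (L₂-spec z))))

  card-resp : ∀ {P Q k} → (∀ z → P z ⇔ Q z) → HasCard′ P k → HasCard′ Q k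
  card-resp P⇔Q (L , (u , L-spec) , len) =
    L , (u , λ z → mk⇔ (to (P⇔Q z) ∘ to (L-spec z)) (from (L-spec z) ∘ from (P⇔Q z))) , len

  card-∅ : ∀ {P} → (∀ z → ¬ P z) → HasCard′ P 0
  card-∅ ¬P = [] , ([] , λ z → mk⇔ (λ ()) (⊥-elim ∘ ¬P z)) , refl

  card-singleton : ∀ {P} a → (∀ z → P z ⇔ z ≡ a) → HasCard′ P 1
  card-singleton a P⇔≡a =
    a ∷ [] , (([] ∷ []) , λ z → mk⇔ (λ { (here z≡a) → from (P⇔≡a z) z≡a ; (there ()) }) (here ∘ to (P⇔≡a z))) , refl

  card-⊎ : ∀ {P Q k l} → (∀ z → P z → Q z → ⊥) → HasCard′ P k → HasCard′ Q l → HasCard′ (λ z → P z ⊎ Q z) (k + l)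
  card-⊎ {P} {Q} disjoint (L₁ , (u₁ , L₁-spec) , refl) (L₂ , (u₂ , L₂-spec) , refl) =
    L₁ ++ L₂ , (Unique.++⁺ u₁ u₂ (λ { {z} (z∈L₁ , z∈L₂) → disjoint z (to (L₁-spec z) z∈L₁) (to (L₂-spec z) z∈L₂) }) , spec) ,
    length-++ L₁
    where
    spec : ∀ z → z ∈ L₁ ++ L₂ ⇔ (P z ⊎ Q z)
    spec z = mk⇔ ([ inj₁ ∘ to (L₁-spec z) , inj₂ ∘ to (L₂-spec z) ] ∘ ∈-++⁻ L₁)
                 [ ∈-++⁺ˡ ∘ from (L₁-spec z) , ∈-++⁺ʳ L₁ ∘ from (L₂-spec z) ]

module _ {A B : Set} where

  Image : (A → B) → (A → Set) → B → Set
  Image f P z = ∃[ w ] P w × f w ≡ z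

  card-image : ∀ {P k} (f : A → B) → Injective _≡_ _≡_ f → HasCard′ P k → HasCard′ (Image f P) k
  card-image {P} f f-inj (L , (u , L-spec) , refl) =
    map f L , (Unique.map⁺ f-inj u , spec) , length-map f L
    where
    spec : ∀ z → z ∈ map f L ⇔ Image f P z
    spec z = mk⇔ (λ z∈fL → let (w , w∈L , z≡fw) = ∈-map⁻ f z∈fL in w , to (L-spec w) w∈L , sym z≡fw)
                 (λ { (w , Pw , refl) → ∈-map⁺ f (from (L-spec w) Pw) })

module _ {A I : Set} where

  card-⋃ : ∀ {P : I → A → Set} {k : I → ℕ} (Is : List I) → Unique Is
         → (∀ {i j z} → i ∈ Is → j ∈ Is → P i z → P j z → i ≡ j)
         → (∀ {i} → i ∈ Is → HasCard′ (P i) (k i))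
         → HasCard′ (λ z → ∃[ i ] i ∈ Is × P i z) (sum (map k Is))
  card-⋃ []       _        _        _    = card-∅ λ { _ (_ , () , _) }
  card-⋃ {P} (i ∷ Is) (i∉Is ∷ u) disjoint card-P =
    card-resp spec (card-⊎ disjoint-i (card-P (here refl))
      (card-⋃ Is u (λ i∈ j∈ → disjoint (there i∈) (there j∈)) (card-P ∘ there)))
    where
    disjoint-i : ∀ z → P i z → (∃[ j ] j ∈ Is × P j z) → ⊥
    disjoint-i z Piz (j , j∈Is , Pjz) = lookup i∉Is j∈Is (disjoint (here refl) (there j∈Is) Piz Pjz)
    spec : ∀ z → (P i z ⊎ ∃[ j ] j ∈ Is × P j z) ⇔ (∃[ j ] j ∈ i ∷ Is × P j z)
    spec z = mk⇔ [ (λ Piz → i , here refl , Piz) , (λ { (j , j∈ , Pjz) → j , there j∈ , Pjz }) ]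
                 λ { (j , here refl , Pjz) → inj₁ Pjz ; (j , there j∈ , Pjz) → inj₂ (j , j∈ , Pjz) }

totalDegree : ∀ {r} → Vec Tree r → ℕ
totalDegree []      = 0
totalDegree (t ∷ f) = degree t + totalDegree f

Forest : ℕ → (r : ℕ) → Vec Tree r → Set
Forest n r f = totalDegree f ≡ n

graft : ∀ {r} → Vec Tree (2 + r) → Vec Tree (1 + r)
graft (a ∷ b ∷ f) = (a ∨ b) ∷ f

graft-injective : ∀ {r} → Injective _≡_ _≡_ (graft {r})
graft-injective {x = _ ∷ _ ∷ _} {y = _ ∷ _ ∷ _} refl = refl

forest-degree-0 : ∀ {r} (f : Vec Tree r) → Forest 0 r f ⇔ f ≡ replicate r leaf
forest-degree-0 {r} f = mk⇔ (only-leaves f) λ { refl → leaves-degree r }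
  where
  only-leaves : ∀ {r} (f : Vec Tree r) → Forest 0 r f → f ≡ replicate r leaf
  only-leaves []             _ = refl
  only-leaves (leaf ∷ f)     d = cong (leaf ∷_) (only-leaves f d)
  only-leaves ((_ ∨ _) ∷ _) ()
  leaves-degree : ∀ r → Forest 0 r (replicate r leaf)
  leaves-degree zero    = refl
  leaves-degree (suc r) = leaves-degree r

forest-cases : ∀ {n r} (f : Vec Tree (suc r)) →
  (Image (leaf ∷_) (Forest (suc n) r) f ⊎ Image graft (Forest n (suc (suc r))) f) ⇔ Forest (suc n) (suc r) f
forest-cases {n} {r} f = mk⇔ join (split f)
  where
  join : Image (leaf ∷_) (Forest (suc n) r) f ⊎ Image graft (Forest n (suc (suc r))) f → Forest (suc n) (suc r) f
  join (inj₁ (_ , d , refl))         = d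
  join (inj₂ (a ∷ b ∷ w , d , refl)) = cong suc (trans (+-assoc (degree a) (degree b) (totalDegree w)) d)
  split : ∀ g → Forest (suc n) (suc r) g → Image (leaf ∷_) (Forest (suc n) r) g ⊎ Image graft (Forest n (suc (suc r))) g
  split (leaf ∷ w)    d = inj₁ (w , d , refl)
  split ((a ∨ b) ∷ w) d = inj₂ (a ∷ b ∷ w , trans (sym (+-assoc (degree a) (degree b) (totalDegree w))) (suc-injective d) , refl)

card-forest : ∀ n r → HasCard′ (Forest n r) (ballot n r)
card-forest zero    r       = card-singleton (replicate r leaf) forest-degree-0
card-forest (suc n) zero    = card-∅ λ { [] () }
card-forest (suc n) (suc r) = card-resp forest-cases
  (card-⊎ leaf-first≢graft (card-image (leaf ∷_) ∷-injectiveʳ (card-forest (suc n) r))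
                          (card-image graft graft-injective (card-forest n (suc (suc r)))))
  where
  leaf-first≢graft : ∀ f → Image (leaf ∷_) (Forest (suc n) r) f → Image graft (Forest n (suc (suc r))) f → ⊥
  leaf-first≢graft _ (_ , _ , refl) (_ ∷ _ ∷ _ , _ , ())

card-Y : ∀ k → HasCard (InY k) (catalan k)
card-Y k = subst (HasCard (InY k)) (sym (catalan-ballot k))
  (card-resp trees-as-forests (card-image head head-injective (card-forest k 1)))
  where
  head-injective : Injective _≡_ _≡_ (head {n = 0})
  head-injective {x = _ ∷ []} {y = _ ∷ []} refl = refl
  trees-as-forests : ∀ z → Image head (Forest k 1) z ⇔ InY k z
  trees-as-forests z = mk⇔ (λ { (t ∷ [] , d , refl) → trans (sym (+-identityʳ (degree t))) d })
                           (λ d → z ∷ [] , trans (+-identityʳ (degree z)) d , refl)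

≤T-reflexive : ∀ {x y} → x ≡ y → x ≤T y
≤T-reflexive refl = ≤T-refl

≤T-isPreorder : IsPreorder _≡_ _≤T_
≤T-isPreorder = record
  { isEquivalence = isEquivalence
  ; reflexive     = ≤T-reflexive
  ; trans         = ≤T-trans
  }

≤T-preorder : Preorder _ _ _
≤T-preorder = record { isPreorder = ≤T-isPreorder }

module ≤T-Reasoning = PreorderReasoning ≤T-preorder

≤T-degree : ∀ {x y} → x ≤T y → degree x ≡ degree y
≤T-degree ≤T-refl        = refl
≤T-degree (≤T-trans p q) = trans (≤T-degree p) (≤T-degree q)
≤T-degree (≤T-rot {a} {b} {c}) = cong suc (+-suc-assoc (degree a) (degree b) (degree c))
  where
  +-suc-assoc : ∀ a b c → suc (a + b) + c ≡ a + suc (b + c)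
  +-suc-assoc = solve-∀
≤T-degree (≤T-left {c = c} p)  = cong (λ d → suc (d + degree c)) (≤T-degree p)
≤T-degree (≤T-right {c = c} p) = cong (λ d → suc (degree c + d)) (≤T-degree p)

-- A rotation (a ∨ b) ∨ c → a ∨ (b ∨ c) raises the weight by 1 + degree c.
weight : Tree → ℕ
weight leaf    = 0
weight (a ∨ c) = weight a + weight c + degree c

≤T-weight : ∀ {x y} → x ≤T y → x ≡ y ⊎ weight x < weight y
≤T-weight ≤T-refl = inj₁ refl
≤T-weight (≤T-trans p q) with ≤T-weight p | ≤T-weight q
... | inj₁ refl | r        = r
... | inj₂ l    | inj₁ refl = inj₂ l
... | inj₂ l    | inj₂ l′   = inj₂ (<-trans l l′)
≤T-weight (≤T-rot {a} {b} {c}) =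
  inj₂ (subst (weight ((a ∨ b) ∨ c) <_) (sym (rotation-weight (weight a) (weight b) (weight c) (degree b) (degree c)))
              (m<m+n _ z<s))
  where
  rotation-weight : ∀ wa wb wc db dc → wa + (wb + wc + dc) + suc (db + dc) ≡ wa + wb + db + wc + dc + suc dc
  rotation-weight = solve-∀
≤T-weight (≤T-left {c = c} p) with ≤T-weight p
... | inj₁ refl = inj₁ refl
... | inj₂ l    = inj₂ (+-monoˡ-< (degree c) (+-monoˡ-< (weight c) l))
≤T-weight (≤T-right {a} {b} {c} p) with ≤T-weight p
... | inj₁ refl = inj₁ refl
... | inj₂ l    = inj₂ (subst (λ d → weight c + weight a + degree a < weight c + weight b + d) (≤T-degree p)
                              (+-monoˡ-< (degree a) (+-monoʳ-< (weight c) l)))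

≤T-antisym : ∀ {x y} → x ≤T y → y ≤T x → x ≡ y
≤T-antisym p q with ≤T-weight p | ≤T-weight q
... | inj₁ x≡y | _        = x≡y
... | inj₂ _   | inj₁ y≡x = sym y≡x
... | inj₂ l   | inj₂ l′  = ⊥-elim (<-asym l l′)

≤T-squeeze : (f : Tree → Tree) → (∀ {u v} → u ≤T v → f u ≤T f v) →
             ∀ {u v z w} → u ≤T z → z ≤T v → f u ≡ w → f v ≡ w → f z ≡ w
≤T-squeeze f f-mono {u} {v} {z} {w} u≤z z≤v refl fv≡fu =
  sym (≤T-antisym (f-mono u≤z) (begin f z ≲⟨ f-mono z≤v ⟩ f v ≡⟨ fv≡fu ⟩ f u ∎))
  where open ≤T-Reasoning

data Side (n d : ℕ) : Set where
  left  : n ≤ d → Side n d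
  right : ∀ k → n ≡ suc (d + k) → Side n d

side : ∀ n d → Side n d
side zero    d       = left z≤n
side (suc n) zero    = right n refl
side (suc n) (suc d) with side n d
... | left n≤d     = left (s≤s n≤d)
... | right k n≡dk = right k (cong suc n≡dk)

-- With the leaves of z numbered 0 … degree z from the left, cutˡ n z is the tree spanned by
-- the leaves 0 … n and cutʳ n z the tree spanned by the leaves n … degree z.
cutˡ : ℕ → Tree → Tree
cutˡ n leaf = leaf
cutˡ n (a ∨ b) with side n (degree a)
... | left _    = cutˡ n a
... | right k _ = a ∨ cutˡ k b

cutʳ : ℕ → Tree → Tree
cutʳ n leaf = leaf
cutʳ n (a ∨ b) with side n (degree a)
... | left _    = cutʳ n a ∨ b
... | right k _ = cutʳ k b

private
  ≤⇒≢suc+ : ∀ {n d k} → n ≤ d → n ≢ suc (d + k)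
  ≤⇒≢suc+ {d = d} {k} n≤d refl = <⇒≱ (s≤s (m≤m+n d k)) n≤d

module _ (a b : Tree) where

  cutˡ-left : ∀ {n} → n ≤ degree a → cutˡ n (a ∨ b) ≡ cutˡ n a
  cutˡ-left {n} n≤d with side n (degree a)
  ... | left _    = refl
  ... | right _ e = ⊥-elim (≤⇒≢suc+ n≤d e)

  cutʳ-left : ∀ {n} → n ≤ degree a → cutʳ n (a ∨ b) ≡ cutʳ n a ∨ b
  cutʳ-left {n} n≤d with side n (degree a)
  ... | left _    = refl
  ... | right _ e = ⊥-elim (≤⇒≢suc+ n≤d e)

  cutˡ-right : ∀ {n} k → n ≡ suc (degree a + k) → cutˡ n (a ∨ b) ≡ a ∨ cutˡ k b
  cutˡ-right {n} k refl with side n (degree a)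
  ... | left n≤d = ⊥-elim (≤⇒≢suc+ n≤d refl)
  ... | right j e with +-cancelˡ-≡ (degree a) k j (suc-injective e)
  ...   | refl = refl

  cutʳ-right : ∀ {n} k → n ≡ suc (degree a + k) → cutʳ n (a ∨ b) ≡ cutʳ k b
  cutʳ-right {n} k refl with side n (degree a)
  ... | left n≤d = ⊥-elim (≤⇒≢suc+ n≤d refl)
  ... | right j e with +-cancelˡ-≡ (degree a) k j (suc-injective e)
  ...   | refl = refl

degree-cut : ∀ n z → degree (cutˡ n z) + degree (cutʳ n z) ≡ degree z
degree-cut n leaf = refl
degree-cut n (a ∨ b) with side n (degree a)
... | left _ = trans (+-suc (degree (cutˡ n a)) _)
  (cong suc (trans (sym (+-assoc (degree (cutˡ n a)) (degree (cutʳ n a)) (degree b)))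
                   (cong (_+ degree b) (degree-cut n a))))
... | right k _ = cong suc (trans (+-assoc (degree a) _ _) (cong (degree a +_) (degree-cut k b)))

degree-cutˡ : ∀ {n} z → n ≤ degree z → degree (cutˡ n z) ≡ n
degree-cutˡ leaf z≤n = refl
degree-cutˡ {n} (a ∨ b) n≤d with side n (degree a)
... | left n≤da    = degree-cutˡ a n≤da
... | right k refl = cong (λ j → suc (degree a + j)) (degree-cutˡ b (+-cancelˡ-≤ (degree a) k (degree b) (s≤s⁻¹ n≤d)))

cut-degrees : ∀ {n m} z → degree z ≡ n + m → degree (cutˡ n z) ≡ n × degree (cutʳ n z) ≡ m
cut-degrees {n} {m} z d≡n+m = degreeˡ , +-cancelˡ-≡ n _ _ (begin
    n + degree (cutʳ n z)                  ≡⟨ cong (_+ degree (cutʳ n z)) degreeˡ ⟨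
    degree (cutˡ n z) + degree (cutʳ n z)  ≡⟨ degree-cut n z ⟩
    degree z                               ≡⟨ d≡n+m ⟩
    n + m                                  ∎)
  where
  open ≡-Reasoning
  degreeˡ : degree (cutˡ n z) ≡ n
  degreeˡ = degree-cutˡ z (subst (n ≤_) (sym d≡n+m) (m≤m+n n m))

rotate-╲T : ∀ x y b → ((x ╲T y) ∨ b) ≤T (x ╲T (y ∨ b))
rotate-╲T leaf    y b = ≤T-refl
rotate-╲T (l ∨ r) y b = ≤T-trans ≤T-rot (≤T-right (rotate-╲T r y b))

rotate-/T : ∀ a v y → ((a ∨ v) /T y) ≤T (a ∨ (v /T y))
rotate-/T a v leaf    = ≤T-refl
rotate-/T a v (l ∨ r) = ≤T-trans (≤T-left (rotate-/T a v l)) ≤T-rot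

cut-lower : ∀ n z → (cutˡ n z /T cutʳ n z) ≤T z
cut-lower n leaf = ≤T-refl
cut-lower n (a ∨ b) with side n (degree a)
... | left _    = ≤T-left (cut-lower n a)
... | right k _ = ≤T-trans (rotate-/T a (cutˡ k b) (cutʳ k b)) (≤T-right (cut-lower k b))

cut-upper : ∀ n z → z ≤T (cutˡ n z ╲T cutʳ n z)
cut-upper n leaf = ≤T-refl
cut-upper n (a ∨ b) with side n (degree a)
... | left _    = ≤T-trans (≤T-left (cut-upper n a)) (rotate-╲T (cutˡ n a) (cutʳ n a) b)
... | right k _ = ≤T-right (cut-upper k b)

degree-/T : ∀ x y → degree (x /T y) ≡ degree x + degree y
degree-/T x leaf    = sym (+-identityʳ (degree x))
degree-/T x (l ∨ r) = begin
  suc (degree (x /T l) + degree r)      ≡⟨ cong (λ d → suc (d + degree r)) (degree-/T x l) ⟩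
  suc (degree x + degree l + degree r)  ≡⟨ cong suc (+-assoc (degree x) (degree l) (degree r)) ⟩
  suc (degree x + (degree l + degree r)) ≡⟨ +-suc (degree x) _ ⟨
  degree x + suc (degree l + degree r)  ∎
  where open ≡-Reasoning

cutˡ-degree : ∀ t → cutˡ (degree t) t ≡ t
cutˡ-degree leaf    = refl
cutˡ-degree (a ∨ b) = trans (cutˡ-right a b (degree b) refl) (cong (a ∨_) (cutˡ-degree b))

cutʳ-degree : ∀ t → cutʳ (degree t) t ≡ leaf
cutʳ-degree leaf    = refl
cutʳ-degree (a ∨ b) = trans (cutʳ-right a b (degree b) refl) (cutʳ-degree b)

cutˡ-zero : ∀ t → cutˡ 0 t ≡ leaf
cutˡ-zero leaf    = refl
cutˡ-zero (a ∨ b) = trans (cutˡ-left a b z≤n) (cutˡ-zero a)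

cutʳ-zero : ∀ t → cutʳ 0 t ≡ t
cutʳ-zero leaf    = refl
cutʳ-zero (a ∨ b) = trans (cutʳ-left a b z≤n) (cong (_∨ b) (cutʳ-zero a))

private
  degree-≤-/T : ∀ x l → degree x ≤ degree (x /T l)
  degree-≤-/T x l = subst (degree x ≤_) (sym (degree-/T x l)) (m≤m+n (degree x) (degree l))

cutˡ-/T : ∀ x y → cutˡ (degree x) (x /T y) ≡ x
cutˡ-/T x leaf    = cutˡ-degree x
cutˡ-/T x (l ∨ r) = trans (cutˡ-left (x /T l) r (degree-≤-/T x l)) (cutˡ-/T x l)

cutʳ-/T : ∀ x y → cutʳ (degree x) (x /T y) ≡ y
cutʳ-/T x leaf    = cutʳ-degree x
cutʳ-/T x (l ∨ r) = trans (cutʳ-left (x /T l) r (degree-≤-/T x l)) (cong (_∨ r) (cutʳ-/T x l))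

cutˡ-╲T : ∀ x y → cutˡ (degree x) (x ╲T y) ≡ x
cutˡ-╲T leaf    y = cutˡ-zero y
cutˡ-╲T (l ∨ r) y = trans (cutˡ-right l (r ╲T y) (degree r) refl) (cong (l ∨_) (cutˡ-╲T r y))

cutʳ-╲T : ∀ x y → cutʳ (degree x) (x ╲T y) ≡ y
cutʳ-╲T leaf    y = cutʳ-zero y
cutʳ-╲T (l ∨ r) y = trans (cutʳ-right l (r ╲T y) (degree r) refl) (cutʳ-╲T r y)

private
  degree-≤-∨ : ∀ {n} a b → n ≤ degree a → n ≤ degree (a ∨ b)
  degree-≤-∨ a b n≤a = ≤-trans n≤a (≤-trans (m≤m+n (degree a) (degree b)) (n≤1+n _))

  rotation-index : ∀ a b j → suc (a + suc (b + j)) ≡ suc (suc (a + b) + j)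
  rotation-index = solve-∀

module _ (a b c : Tree) where
  open ≤T-Reasoning

  cutˡ-rotation : ∀ n → cutˡ n ((a ∨ b) ∨ c) ≤T cutˡ n (a ∨ (b ∨ c))
  cutˡ-rotation n with side n (degree a)
  ... | left n≤a = begin
    cutˡ n ((a ∨ b) ∨ c) ≡⟨ cutˡ-left (a ∨ b) c (degree-≤-∨ a b n≤a) ⟩
    cutˡ n (a ∨ b)       ≡⟨ cutˡ-left a b n≤a ⟩
    cutˡ n a             ∎
  ... | right k refl with side k (degree b)
  ...   | left k≤b = begin
    cutˡ n ((a ∨ b) ∨ c) ≡⟨ cutˡ-left (a ∨ b) c (s≤s (+-monoʳ-≤ (degree a) k≤b)) ⟩
    cutˡ n (a ∨ b)       ≡⟨ cutˡ-right a b k refl ⟩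
    a ∨ cutˡ k b         ∎
  ...   | right j refl = begin
    cutˡ n ((a ∨ b) ∨ c)  ≡⟨ cutˡ-right (a ∨ b) c j (rotation-index (degree a) (degree b) j) ⟩
    (a ∨ b) ∨ cutˡ j c   ≲⟨ ≤T-rot ⟩
    a ∨ (b ∨ cutˡ j c)   ∎

  cutʳ-rotation : ∀ n → cutʳ n ((a ∨ b) ∨ c) ≤T cutʳ n (a ∨ (b ∨ c))
  cutʳ-rotation n with side n (degree a)
  ... | left n≤a = begin
    cutʳ n ((a ∨ b) ∨ c)      ≡⟨ cutʳ-left (a ∨ b) c (degree-≤-∨ a b n≤a) ⟩
    cutʳ n (a ∨ b) ∨ c        ≡⟨ cong (_∨ c) (cutʳ-left a b n≤a) ⟩
    (cutʳ n a ∨ b) ∨ c        ≲⟨ ≤T-rot ⟩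
    cutʳ n a ∨ (b ∨ c)        ∎
  ... | right k refl with side k (degree b)
  ...   | left k≤b = begin
    cutʳ n ((a ∨ b) ∨ c) ≡⟨ cutʳ-left (a ∨ b) c (s≤s (+-monoʳ-≤ (degree a) k≤b)) ⟩
    cutʳ n (a ∨ b) ∨ c   ≡⟨ cong (_∨ c) (cutʳ-right a b k refl) ⟩
    cutʳ k b ∨ c         ∎
  ...   | right j refl = begin
    cutʳ n ((a ∨ b) ∨ c) ≡⟨ cutʳ-right (a ∨ b) c j (rotation-index (degree a) (degree b) j) ⟩
    cutʳ j c             ∎

cutˡ-mono : ∀ n {x y} → x ≤T y → cutˡ n x ≤T cutˡ n y
cutˡ-mono n ≤T-refl                = ≤T-refl
cutˡ-mono n (≤T-trans p q)         = ≤T-trans (cutˡ-mono n p) (cutˡ-mono n q)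
cutˡ-mono n (≤T-rot {a} {b} {c})   = cutˡ-rotation a b c n
cutˡ-mono n (≤T-left {a} {b} {c} p) with side n (degree a)
... | left n≤a = begin
  cutˡ n a        ≲⟨ cutˡ-mono n p ⟩
  cutˡ n b        ≡⟨ cutˡ-left b c (subst (n ≤_) (≤T-degree p) n≤a) ⟨
  cutˡ n (b ∨ c)  ∎
  where open ≤T-Reasoning
... | right k n≡ = begin
  a ∨ cutˡ k c    ≲⟨ ≤T-left p ⟩
  b ∨ cutˡ k c    ≡⟨ cutˡ-right b c k (trans n≡ (cong (λ d → suc (d + k)) (≤T-degree p))) ⟨
  cutˡ n (b ∨ c)  ∎
  where open ≤T-Reasoning
cutˡ-mono n (≤T-right {c = c} p) with side n (degree c)
... | left _    = ≤T-refl
... | right k _ = ≤T-right (cutˡ-mono k p)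

cutʳ-mono : ∀ n {x y} → x ≤T y → cutʳ n x ≤T cutʳ n y
cutʳ-mono n ≤T-refl                = ≤T-refl
cutʳ-mono n (≤T-trans p q)         = ≤T-trans (cutʳ-mono n p) (cutʳ-mono n q)
cutʳ-mono n (≤T-rot {a} {b} {c})   = cutʳ-rotation a b c n
cutʳ-mono n (≤T-left {a} {b} {c} p) with side n (degree a)
... | left n≤a = begin
  cutʳ n a ∨ c    ≲⟨ ≤T-left (cutʳ-mono n p) ⟩
  cutʳ n b ∨ c    ≡⟨ cutʳ-left b c (subst (n ≤_) (≤T-degree p) n≤a) ⟨
  cutʳ n (b ∨ c)  ∎
  where open ≤T-Reasoning
... | right k n≡ = ≤T-reflexive (sym (cutʳ-right b c k (trans n≡ (cong (λ d → suc (d + k)) (≤T-degree p)))))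
cutʳ-mono n (≤T-right {c = c} p) with side n (degree c)
... | left _    = ≤T-right p
... | right k _ = cutʳ-mono k p

grove-cut : ∀ {n m x y z} → degree x ≡ n → Grove n m x y z → cutˡ n z ≡ x × cutʳ n z ≡ y
grove-cut {x = x} {y} refl (_ , lower , upper) =
  ≤T-squeeze (cutˡ (degree x)) (cutˡ-mono (degree x)) lower upper (cutˡ-/T x y) (cutˡ-╲T x y) ,
  ≤T-squeeze (cutʳ (degree x)) (cutʳ-mono (degree x)) lower upper (cutʳ-/T x y) (cutʳ-╲T x y)

module _ {n m : ℕ} {Yn Ym : List Tree} (Yn-enum : Enumerates (InY n) Yn) (Ym-enum : Enumerates (InY m) Ym) where
  Groves : Tree → Set
  Groves z = ∃[ x ] x ∈ Yn × ∃[ y ] y ∈ Ym × Grove n m x y z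

  groves-partition : ∀ z → Groves z ⇔ InY (n + m) z
  groves-partition z = mk⇔ (λ { (_ , _ , _ , _ , d , _) → d }) λ d →
    let dˡ , dʳ = cut-degrees z d in
    cutˡ n z , from (proj₂ Yn-enum _) dˡ , cutʳ n z , from (proj₂ Ym-enum _) dʳ , d , cut-lower n z , cut-upper n z

  card-groves : (c : Tree → Tree → ℕ) → (∀ x y → x ∈ Yn → y ∈ Ym → HasCard (Grove n m x y) (c x y))
              → HasCard Groves (ΣΣ Yn Ym c)
  card-groves c c-card = card-⋃ Yn (proj₁ Yn-enum) same-x λ x∈Yn →
    card-⋃ Ym (proj₁ Ym-enum) (same-y x∈Yn) (c-card _ _ x∈Yn)
    where
    degree-n : ∀ {x} → x ∈ Yn → degree x ≡ n
    degree-n {x} = to (proj₂ Yn-enum x)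
    same-y : ∀ {x y y′ z} → x ∈ Yn → y ∈ Ym → y′ ∈ Ym → Grove n m x y z → Grove n m x y′ z → y ≡ y′
    same-y x∈Yn _ _ g g′ = trans (sym (proj₂ (grove-cut (degree-n x∈Yn) g))) (proj₂ (grove-cut (degree-n x∈Yn) g′))
    same-x : ∀ {x x′ z} → x ∈ Yn → x′ ∈ Yn → (∃[ y ] y ∈ Ym × Grove n m x y z) → (∃[ y ] y ∈ Ym × Grove n m x′ y z) → x ≡ x′
    same-x x∈Yn x′∈Yn (_ , _ , g) (_ , _ , g′) =
      trans (sym (proj₁ (grove-cut (degree-n x∈Yn) g))) (proj₁ (grove-cut (degree-n x′∈Yn) g′))

proposition7p1 : (n m : ℕ) (Yn Ym : List Tree)
    → Enumerates (InY n) Yn → Enumerates (InY m) Ym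
    → (c : Tree → Tree → ℕ)
    → (∀ x y → x ∈ Yn → y ∈ Ym → HasCard (Grove n m x y) (c x y))
    → ΣΣ Yn Ym c ≡ catalan (n + m)
proposition7p1 n m Yn Ym Yn-enum Ym-enum c c-card =
  card-unique (card-resp (groves-partition Yn-enum Ym-enum) (card-groves Yn-enum Ym-enum c c-card)) (card-Y (n + m))
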